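{- Let $j$ and $m$ be positive integers with $j\le m$. Then $$\sum_{k=1}^m\left( \left[\frac{m}{jk}\right] - 2\left[\frac{m}{2jk}\right]\right) \mu(k)= \begin{cases} -1 & \text{if } j\le m/2, \\ 1 & \text{if } m/2 < j \le m. \end{cases}$$
   Context: $\mu$ denotes the Möbius function and $[x]$ denotes the greatest integer less than or equal to $x$ (floor function). -}

module Defs where

open import Data.Nat using (ℕ; zero; suc; _*_; _^_)
open import Data.Nat.Divisibility using (_∣_; _∣?_)
open import Data.Nat.Primality using (Prime; prime?)
open import Data.Nat.DivMod using (_/_)
open import Data.Integer as ℤ using (ℤ; +_; -_)
open import Data.List using (List; filter; length; upTo; map; sum)
open import Data.List.Relation.Unary.Any using (any?)
open import Relation.Nullary.Decidable using (does; _×-dec_)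
open import Data.Bool using (if_then_else_)

-- Primes dividing k, listed among 0 .. k (any prime divisor of k ≥ 1 is ≤ k).
primeDivisors : ℕ → List ℕ
primeDivisors k = filter (λ p → prime? p ×-dec (p ∣? k)) (upTo (suc k))

hasSquareFactor : ℕ → Set _
hasSquareFactor k = Data.List.Relation.Unary.Any.Any (λ p → (p * p) ∣ k) (primeDivisors k)

μ : ℕ → ℤ
μ k = if does (any? (λ p → (p * p) ∣? k) (primeDivisors k))
      then + 0
      else (- + 1) ℤ.^ length (primeDivisors k)

sumFrom1 : ℕ → (ℕ → ℤ) → ℤ
sumFrom1 zero f = + 0
sumFrom1 (suc m) f = sumFrom1 m f ℤ.+ f (suc m)

-- floor(m / n) for n ≥ 1 (value at n = 0 is irrelevant, set to 0)
⌊_/_⌋ : ℕ → ℕ → ℕ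
⌊ m / zero ⌋ = 0
⌊ m / suc n ⌋ = m / suc n

-- Since ⌊m/(jk)⌋ = ⌊⌊m/j⌋/k⌋, the sum equals F(⌊m/j⌋) − 2 F(⌊m/2j⌋) with F(x) = Σ_{k ≤ m} ⌊x/k⌋ μ(k).
-- As ⌊(x+1)/k⌋ − ⌊x/k⌋ = [k ∣ x+1], F(x+1) − F(x) is the divisor sum Σ_{k ∣ x+1} μ(k), which is 1
-- for x = 0 and 0 otherwise; hence F(x) = 1 for 1 ≤ x ≤ m, while F(0) = 0.  The divisor sum
-- vanishes at N = p M (p prime) because μ(p k) = −μ(k) for p ∤ k and μ(p k) = 0 for p ∣ k, so the
-- divisors of N divisible by p cancel those that are not.
module Submission where

open import Defs
open import Data.Nat using (ℕ; _*_; _≤_; _<_)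
open import Data.Integer as ℤ using (ℤ; +_; -_)
open import Data.Product using (_×_)
open import Relation.Binary.PropositionalEquality using (_≡_)

open import Level using (Level)
open import Function using (_∘_)
open import Data.Bool using (if_then_else_)
open import Data.Empty using (⊥-elim)
open import Data.Sum using (_⊎_; inj₁; inj₂)
open import Data.Product using (∃-syntax; _,_; proj₁; proj₂)
open import Data.Nat using (zero; suc; _+_; _≟_; z≤n; s≤s; NonZero; >-nonZero)
open import Data.Nat.Properties
open import Data.Nat.DivMod using (_/_; _%_; m≡m%n+[m/n]*n; m%n<n; m*n/n≡m; m<n⇒m/n≡0;
  +-distrib-/-∣ˡ; m/n/o≡m/[n*o]; m/n≤m; m≥n⇒m/n>0; /-congˡ)
open import Data.Nat.Divisibility
open import Data.Nat.Primality using (Prime; prime?; euclidsLemma; prime⇒irreducible;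
  prime⇒nonZero; ¬prime[1])
open import Data.Nat.Primality.Factorisation using (factorise)
open import Data.Nat.Coprimality using (Coprime; coprime-divisor)
import Data.Integer.Properties as ℤ
open import Data.Integer.Solver using (module +-*-Solver)
open import Algebra.Properties.CommutativeSemigroup ℤ.+-commutativeSemigroup using (interchange)
open import Data.List using ([]; _∷_; [_]; _++_; _∷ʳ_; filter; length; upTo)
open import Data.Nat.ListAction using (product)
import Data.List.Relation.Unary.All as All
open import Data.List.Properties using (upTo-∷ʳ; filter-++; length-++)
open import Data.List.Membership.Propositional using (_∈_; find; lose)
open import Data.List.Membership.Propositional.Properties using (∈-upTo⁺; ∈-filter⁺; ∈-filter⁻)
open import Data.List.Relation.Unary.Any using (any?)
open import Relation.Nullary using (Dec; yes; no; ¬_)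
open import Relation.Nullary.Decidable using (¬?; _×-dec_; dec-true; dec-false)
open import Relation.Unary using (Pred; Decidable)
open import Relation.Binary.PropositionalEquality using (refl; sym; trans; cong; cong₂; subst;
  module ≡-Reasoning)

private variable
  a ℓ : Level
  A : Set a
  P Q : Pred ℕ ℓ

𝟙 : Dec A → ℕ
𝟙 (yes _) = 1
𝟙 (no _)  = 0

when : Dec A → ℤ → ℤ
when (yes _) z = z
when (no _)  _ = + 0

when-yes : (A? : Dec A) → A → ∀ z → when A? z ≡ z
when-yes (yes _) _ _ = refl
when-yes (no ¬a) a _ = ⊥-elim (¬a a)

when-no : (A? : Dec A) → ¬ A → ∀ z → when A? z ≡ + 0
when-no (yes a) ¬a _ = ⊥-elim (¬a a)
when-no (no _)  _  _ = refl

neg-when : (A? : Dec A) (z : ℤ) → - when A? z ≡ when A? (- z)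
neg-when (yes _) _ = refl
neg-when (no _)  _ = refl

𝟙*≡when : (A? : Dec A) (z : ℤ) → + 𝟙 A? ℤ.* z ≡ when A? z
𝟙*≡when (yes _) z = ℤ.*-identityˡ z
𝟙*≡when (no _)  z = ℤ.*-zeroˡ z

sumFrom1-cong : ∀ {f g} n → (∀ {k} → 1 ≤ k → k ≤ n → f k ≡ g k) → sumFrom1 n f ≡ sumFrom1 n g
sumFrom1-cong zero    _  = refl
sumFrom1-cong (suc n) eq =
  cong₂ ℤ._+_ (sumFrom1-cong n (λ 1≤k k≤n → eq 1≤k (m≤n⇒m≤1+n k≤n))) (eq (s≤s z≤n) ≤-refl)

sumFrom1-zero : ∀ {f} n → (∀ {k} → 1 ≤ k → k ≤ n → f k ≡ + 0) → sumFrom1 n f ≡ + 0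
sumFrom1-zero zero    _  = refl
sumFrom1-zero (suc n) eq =
  cong₂ ℤ._+_ (sumFrom1-zero n (λ 1≤k k≤n → eq 1≤k (m≤n⇒m≤1+n k≤n))) (eq (s≤s z≤n) ≤-refl)

sumFrom1-+ : ∀ f g n → sumFrom1 n (λ k → f k ℤ.+ g k) ≡ sumFrom1 n f ℤ.+ sumFrom1 n g
sumFrom1-+ f g zero    = refl
sumFrom1-+ f g (suc n) rewrite sumFrom1-+ f g n =
  interchange (sumFrom1 n f) (sumFrom1 n g) (f (suc n)) (g (suc n))

sumFrom1-*ˡ : ∀ c f n → sumFrom1 n (λ k → c ℤ.* f k) ≡ c ℤ.* sumFrom1 n f
sumFrom1-*ˡ c f zero    = sym (ℤ.*-zeroʳ c)
sumFrom1-*ˡ c f (suc n) rewrite sumFrom1-*ˡ c f n = sym (ℤ.*-distribˡ-+ c (sumFrom1 n f) (f (suc n)))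

sumFrom1-tail : ∀ f {a b} → a ≤ b → (∀ {k} → a < k → k ≤ b → f k ≡ + 0) →
                sumFrom1 b f ≡ sumFrom1 a f
sumFrom1-tail f {b = zero}  z≤n _ = refl
sumFrom1-tail f {b = suc b} a≤1+b eq with m≤n⇒m<n∨m≡n a≤1+b
... | inj₂ refl = refl
... | inj₁ a<1+b rewrite eq a<1+b ≤-refl =
  trans (ℤ.+-identityʳ _) (sumFrom1-tail f (≤-pred a<1+b) (λ a<k k≤b → eq a<k (m≤n⇒m≤1+n k≤b)))

sumFrom1-++ : ∀ f a b → sumFrom1 (a + b) f ≡ sumFrom1 a f ℤ.+ sumFrom1 b (λ i → f (a + i))
sumFrom1-++ f a zero    rewrite +-identityʳ a = sym (ℤ.+-identityʳ _)
sumFrom1-++ f a (suc b) rewrite +-suc a b | sumFrom1-++ f a b = ℤ.+-assoc (sumFrom1 a f) _ _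

sumFrom1-split : (P? : Decidable P) (f : ℕ → ℤ) → ∀ n →
  sumFrom1 n f ≡ sumFrom1 n (λ k → when (P? k) (f k)) ℤ.+ sumFrom1 n (λ k → when (¬? (P? k)) (f k))
sumFrom1-split P? f n = trans (sumFrom1-cong n (λ {k} _ _ → split k)) (sumFrom1-+ _ _ n)
  where
  split : ∀ k → f k ≡ when (P? k) (f k) ℤ.+ when (¬? (P? k)) (f k)
  split k with P? k
  ... | yes _ = sym (ℤ.+-identityʳ (f k))
  ... | no _  = sym (ℤ.+-identityˡ (f k))

sumFrom1-multiples : ∀ p .{{_ : NonZero p}} (f : ℕ → ℤ) M →
  sumFrom1 (p * M) (λ k → when (p ∣? k) (f k)) ≡ sumFrom1 M (λ k → f (p * k))
sumFrom1-multiples p f zero rewrite *-zeroʳ p = refl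
sumFrom1-multiples p@(suc p-1) f (suc M) = begin
  sumFrom1 (p * suc M) F                                ≡⟨ cong (λ n → sumFrom1 n F) p[1+M]≡ ⟩
  sumFrom1 (p * M + p) F                                ≡⟨ sumFrom1-++ F (p * M) p ⟩
  sumFrom1 (p * M) F ℤ.+ sumFrom1 p (λ i → F (p * M + i)) ≡⟨ cong₂ ℤ._+_ (sumFrom1-multiples p f M) lastBlock ⟩
  sumFrom1 M (λ k → f (p * k)) ℤ.+ f (p * suc M)        ∎
  where
  open ≡-Reasoning
  F : ℕ → ℤ
  F k = when (p ∣? k) (f k)
  p[1+M]≡ : p * suc M ≡ p * M + p
  p[1+M]≡ = trans (*-suc p M) (+-comm p (p * M))
  p∤pM+i : ∀ {i} → 1 ≤ i → i ≤ p-1 → ¬ p ∣ p * M + i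
  p∤pM+i {suc i} _ i<p p∣ = <-irrefl refl (≤-trans (s≤s i<p) (∣⇒≤ (∣m+n∣m⇒∣n p∣ (m∣m*n M))))
  lastBlock : sumFrom1 p (λ i → F (p * M + i)) ≡ f (p * suc M)
  lastBlock = begin
    sumFrom1 p-1 (λ i → F (p * M + i)) ℤ.+ F (p * M + p)
      ≡⟨ cong₂ ℤ._+_ (sumFrom1-zero p-1 (λ 1≤i i≤p-1 → when-no (p ∣? _) (p∤pM+i 1≤i i≤p-1) _))
                     (when-yes (p ∣? _) (subst (p ∣_) p[1+M]≡ (m∣m*n (suc M))) _) ⟩
    + 0 ℤ.+ f (p * M + p) ≡⟨ ℤ.+-identityˡ _ ⟩
    f (p * M + p)         ≡⟨ cong f p[1+M]≡ ⟨
    f (p * suc M)         ∎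

count : {P : Pred ℕ ℓ} → Decidable P → ℕ → ℕ
count P? zero    = 0
count P? (suc n) = count P? n + 𝟙 (P? n)

length-filter-upTo : (P? : Decidable P) → ∀ n → length (filter P? (upTo n)) ≡ count P? n
length-filter-upTo P? zero    = refl
length-filter-upTo P? (suc n) = begin
  length (filter P? (upTo (suc n)))                        ≡⟨ cong (length ∘ filter P?) (upTo-∷ʳ n) ⟨
  length (filter P? (upTo n ∷ʳ n))                         ≡⟨ cong length (filter-++ P? (upTo n) [ n ]) ⟩
  length (filter P? (upTo n) ++ filter P? [ n ])           ≡⟨ length-++ (filter P? (upTo n)) ⟩
  length (filter P? (upTo n)) + length (filter P? [ n ])   ≡⟨ cong₂ _+_ (length-filter-upTo P? n) length-filter-[n] ⟩
  count P? n + 𝟙 (P? n)                                    ∎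
  where
  open ≡-Reasoning
  length-filter-[n] : length (filter P? [ n ]) ≡ 𝟙 (P? n)
  length-filter-[n] with P? n
  ... | yes _ = refl
  ... | no _  = refl

count-cong : (P? : Decidable P) (Q? : Decidable Q) → ∀ n →
  (∀ {i} → i < n → P i → Q i) → (∀ {i} → i < n → Q i → P i) → count P? n ≡ count Q? n
count-cong P? Q? zero    _   _   = refl
count-cong P? Q? (suc n) P⇒Q Q⇒P with P? n | Q? n
... | yes _  | yes _  = cong (_+ 1) (count-cong P? Q? n (P⇒Q ∘ m<n⇒m<1+n) (Q⇒P ∘ m<n⇒m<1+n))
... | no _   | no _   = cong (_+ 0) (count-cong P? Q? n (P⇒Q ∘ m<n⇒m<1+n) (Q⇒P ∘ m<n⇒m<1+n))
... | yes Pn | no ¬Qn = ⊥-elim (¬Qn (P⇒Q ≤-refl Pn))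
... | no ¬Pn | yes Qn = ⊥-elim (¬Pn (Q⇒P ≤-refl Qn))

count-beyond : (P? : Decidable P) → ∀ {a n} → (∀ {i} → a ≤ i → ¬ P i) → a ≤ n → count P? n ≡ count P? a
count-beyond P? {n = zero}  _ z≤n = refl
count-beyond P? {n = suc n} ¬P a≤1+n with m≤n⇒m<n∨m≡n a≤1+n
... | inj₂ refl = refl
... | inj₁ a<1+n with P? n
...   | yes Pn = ⊥-elim (¬P (≤-pred a<1+n) Pn)
...   | no _   = trans (+-identityʳ _) (count-beyond P? ¬P (≤-pred a<1+n))

count-insert : {P Q : Pred ℕ ℓ} (P? : Decidable P) (Q? : Decidable Q) {p : ℕ} →
  (∀ {i} → Q i → P i ⊎ i ≡ p) → (∀ {i} → P i → Q i) → Q p → ¬ P p →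
  ∀ {n} → p < n → count Q? n ≡ suc (count P? n)
count-insert {P = P} {Q} P? Q? {p} Q⇒P∪p P⇒Q Qp ¬Pp {suc n} p<1+n with m≤n⇒m<n∨m≡n p<1+n
... | inj₂ refl with P? p | Q? p
...   | yes Pp | _     = ⊥-elim (¬Pp Pp)
...   | no _   | no ¬Q = ⊥-elim (¬Q Qp)
...   | no _   | yes _ =
  trans (+-comm _ 1) (cong suc (trans (count-cong Q? P? p Q⇒P (λ _ → P⇒Q)) (sym (+-identityʳ _))))
  where
  Q⇒P : ∀ {i} → i < p → Q i → P i
  Q⇒P i<p Qi with Q⇒P∪p Qi
  ... | inj₁ Pi   = Pi
  ... | inj₂ refl = ⊥-elim (<-irrefl refl i<p)
count-insert P? Q? {p} Q⇒P∪p P⇒Q Qp ¬Pp {suc n} p<1+n | inj₁ 1+p<1+n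
  with P? n | Q? n | count-insert P? Q? Q⇒P∪p P⇒Q Qp ¬Pp (≤-pred 1+p<1+n)
... | yes _  | yes _  | ih = cong (_+ 1) ih
... | no _   | no _   | ih = cong (_+ 0) ih
... | yes Pn | no ¬Qn | _  = ⊥-elim (¬Qn (P⇒Q Pn))
... | no ¬Pn | yes Qn | _  with Q⇒P∪p Qn
...   | inj₁ Pn   = ⊥-elim (¬Pn Pn)
...   | inj₂ refl = ⊥-elim (<-irrefl refl (≤-pred 1+p<1+n))

prime-factor : ∀ n → 2 ≤ n → ∃[ p ] Prime p × p ∣ n
prime-factor n 2≤n with factorise n {{>-nonZero (≤-trans (s≤s z≤n) 2≤n)}}
... | record { factors = [] ; isFactorisation = refl } = ⊥-elim (1+n≰n 2≤n)
... | record { factors = p ∷ ps ; isFactorisation = refl ; factorsPrime = Pp All.∷ _ } =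
  p , Pp , m∣m*n (product ps)

prime∣prime⇒≡ : ∀ {q p} → Prime q → Prime p → q ∣ p → q ≡ p
prime∣prime⇒≡ Pq Pp q∣p with prime⇒irreducible Pp q∣p
... | inj₁ refl = ⊥-elim (¬prime[1] Pq)
... | inj₂ q≡p  = q≡p

prime-∤⇒coprime : ∀ {p n} → Prime p → ¬ p ∣ n → Coprime n p
prime-∤⇒coprime Pp p∤n (d∣n , d∣p) with prime⇒irreducible Pp d∣p
... | inj₁ d≡1  = d≡1
... | inj₂ refl = ⊥-elim (p∤n d∣n)

square-∣-cancelˡ : ∀ {p q d} → Prime p → Prime q → ¬ p ∣ d → q * q ∣ p * d → q * q ∣ d
square-∣-cancelˡ {p} {q} Pp Pq p∤d qq∣pd with q ≟ p
... | yes refl = ⊥-elim (p∤d (*-cancelˡ-∣ p {{prime⇒nonZero Pp}} qq∣pd))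
... | no q≢p   = coprime-divisor (prime-∤⇒coprime Pp p∤qq) qq∣pd
  where
  p∤qq : ¬ p ∣ q * q
  p∤qq p∣qq with euclidsLemma q q Pp p∣qq
  ... | inj₁ p∣q = q≢p (sym (prime∣prime⇒≡ Pp Pq p∣q))
  ... | inj₂ p∣q = q≢p (sym (prime∣prime⇒≡ Pp Pq p∣q))

∈-primeDivisors⁻ : ∀ {p k} → p ∈ primeDivisors k → Prime p × p ∣ k
∈-primeDivisors⁻ {k = k} p∈ = proj₂ (∈-filter⁻ (λ p → prime? p ×-dec (p ∣? k)) {xs = upTo (suc k)} p∈)

∈-primeDivisors⁺ : ∀ {p k} .{{_ : NonZero k}} → Prime p → p ∣ k → p ∈ primeDivisors k
∈-primeDivisors⁺ Pp p∣k = ∈-filter⁺ (λ p → prime? p ×-dec (p ∣? _)) (∈-upTo⁺ (s≤s (∣⇒≤ p∣k))) (Pp , p∣k)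

hasSquareFactor⁻ : ∀ {k} → hasSquareFactor k → ∃[ q ] Prime q × q * q ∣ k
hasSquareFactor⁻ {k} sq with find sq
... | q , q∈ , qq∣k = q , proj₁ (∈-primeDivisors⁻ {k = k} q∈) , qq∣k

hasSquareFactor⁺ : ∀ {q k} .{{_ : NonZero k}} → Prime q → q * q ∣ k → hasSquareFactor k
hasSquareFactor⁺ {q} Pq qq∣k = lose (∈-primeDivisors⁺ Pq (∣-trans (m∣m*n q) qq∣k)) qq∣k

μ-squareful : ∀ {k} → hasSquareFactor k → μ k ≡ + 0
μ-squareful {k} sq = cong (λ b → if b then + 0 else (- + 1) ℤ.^ length (primeDivisors k))
                          (dec-true (any? (λ p → p * p ∣? k) (primeDivisors k)) sq)

μ-squarefree : ∀ {k} → ¬ hasSquareFactor k → μ k ≡ (- + 1) ℤ.^ length (primeDivisors k)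
μ-squarefree {k} ¬sq = cong (λ b → if b then + 0 else (- + 1) ℤ.^ length (primeDivisors k))
                            (dec-false (any? (λ p → p * p ∣? k) (primeDivisors k)) ¬sq)

-- The hypothesis d ≠ 0 is needed: primeDivisors 0 is empty, so μ 0 = 1.
module _ {p d : ℕ} .{{_ : NonZero d}} (Pp : Prime p) where
  private instance
    p≢0 : NonZero p
    p≢0 = prime⇒nonZero Pp
    pd≢0 : NonZero (p * d)
    pd≢0 = m*n≢0 p d

  length-primeDivisors-* : ¬ p ∣ d → length (primeDivisors (p * d)) ≡ suc (length (primeDivisors d))
  length-primeDivisors-* p∤d = begin
    length (primeDivisors (p * d)) ≡⟨ length-filter-upTo (Div (p * d)) (suc (p * d)) ⟩
    count (Div (p * d)) (suc (p * d))
      ≡⟨ count-insert (Div d) (Div (p * d)) split (λ (Pi , i∣d) → Pi , ∣n⇒∣m*n p i∣d)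
                      (Pp , m∣m*n d) (p∤d ∘ proj₂) (s≤s (m≤m*n p d)) ⟩
    suc (count (Div d) (suc (p * d))) ≡⟨ cong suc (count-beyond (Div d) beyond (s≤s (m≤n*m d p))) ⟩
    suc (count (Div d) (suc d))       ≡⟨ cong suc (length-filter-upTo (Div d) (suc d)) ⟨
    suc (length (primeDivisors d))    ∎
    where
    open ≡-Reasoning
    Div : ∀ n → Decidable (λ i → Prime i × i ∣ n)
    Div n i = prime? i ×-dec (i ∣? n)
    split : ∀ {i} → Prime i × i ∣ p * d → (Prime i × i ∣ d) ⊎ i ≡ p
    split (Pi , i∣pd) with euclidsLemma p d Pi i∣pd
    ... | inj₁ i∣p = inj₂ (prime∣prime⇒≡ Pi Pp i∣p)
    ... | inj₂ i∣d = inj₁ (Pi , i∣d)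
    beyond : ∀ {i} → suc d ≤ i → ¬ (Prime i × i ∣ d)
    beyond d<i (_ , i∣d) = <-irrefl refl (≤-trans d<i (∣⇒≤ i∣d))

  μ-*-coprime : ¬ p ∣ d → μ (p * d) ≡ - μ d
  μ-*-coprime p∤d = byCases (any? (λ q → q * q ∣? d) (primeDivisors d))
    where
    open ≡-Reasoning
    byCases : Dec (hasSquareFactor d) → μ (p * d) ≡ - μ d
    byCases (yes sq) = let q , Pq , qq∣d = hasSquareFactor⁻ sq in begin
      μ (p * d)   ≡⟨ μ-squareful (hasSquareFactor⁺ Pq (∣n⇒∣m*n p qq∣d)) ⟩
      + 0         ≡⟨ cong -_ (μ-squareful sq) ⟨
      - μ d       ∎
    byCases (no ¬sq) = begin
      μ (p * d)                                        ≡⟨ μ-squarefree ¬sq[pd] ⟩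
      (- + 1) ℤ.^ length (primeDivisors (p * d))       ≡⟨ cong ((- + 1) ℤ.^_) (length-primeDivisors-* p∤d) ⟩
      (- + 1) ℤ.* (- + 1) ℤ.^ length (primeDivisors d) ≡⟨ ℤ.-1*i≡-i _ ⟩
      - ((- + 1) ℤ.^ length (primeDivisors d))         ≡⟨ cong -_ (μ-squarefree ¬sq) ⟨
      - μ d                                            ∎
      where
      ¬sq[pd] : ¬ hasSquareFactor (p * d)
      ¬sq[pd] sq with hasSquareFactor⁻ sq
      ... | q , Pq , qq∣pd = ¬sq (hasSquareFactor⁺ Pq (square-∣-cancelˡ Pp Pq p∤d qq∣pd))

  μ-*-prime : μ (p * d) ≡ when (¬? (p ∣? d)) (- μ d)
  μ-*-prime with p ∣? d
  ... | yes p∣d = μ-squareful (hasSquareFactor⁺ Pp (*-monoʳ-∣ p p∣d))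
  ... | no p∤d  = μ-*-coprime p∤d

μ-divisorSum : ℕ → ℤ
μ-divisorSum N = sumFrom1 N (λ k → when (k ∣? N) (μ k))

μ-divisorSum-prime* : ∀ {p} M .{{_ : NonZero M}} → Prime p → μ-divisorSum (p * M) ≡ + 0
μ-divisorSum-prime* {p} M Pp = begin
  μ-divisorSum (p * M)                                   ≡⟨ sumFrom1-split (p ∣?_) _ (p * M) ⟩
  sumFrom1 (p * M) (λ k → when (p ∣? k) (term k)) ℤ.+ sumFrom1 (p * M) (λ k → when (¬? (p ∣? k)) (term k))
                                                         ≡⟨ cong₂ ℤ._+_ multiples nonMultiples ⟩
  sumFrom1 M (λ k → - g k) ℤ.+ sumFrom1 M g             ≡⟨ sumFrom1-+ (λ k → - g k) g M ⟨
  sumFrom1 M (λ k → - g k ℤ.+ g k)                       ≡⟨ sumFrom1-zero M (λ {k} _ _ → ℤ.+-inverseˡ (g k)) ⟩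
  + 0                                                    ∎
  where
  open ≡-Reasoning
  instance
    p≢0 : NonZero p
    p≢0 = prime⇒nonZero Pp
  term g : ℕ → ℤ
  term k = when (k ∣? p * M) (μ k)
  g k = when (k ∣? M) (when (¬? (p ∣? k)) (μ k))
  multiples : sumFrom1 (p * M) (λ k → when (p ∣? k) (term k)) ≡ sumFrom1 M (λ k → - g k)
  multiples = trans (sumFrom1-multiples p term M) (sumFrom1-cong M pk-term)
    where
    pk-term : ∀ {k} → 1 ≤ k → k ≤ M → term (p * k) ≡ - g k
    pk-term {k@(suc _)} _ _ with k ∣? M
    ... | no k∤M  = when-no (p * k ∣? p * M) (k∤M ∘ *-cancelˡ-∣ p) _
    ... | yes k∣M = begin
      when (p * k ∣? p * M) (μ (p * k)) ≡⟨ when-yes (p * k ∣? p * M) (*-monoʳ-∣ p k∣M) _ ⟩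
      μ (p * k)                          ≡⟨ μ-*-prime Pp ⟩
      when (¬? (p ∣? k)) (- μ k)         ≡⟨ neg-when (¬? (p ∣? k)) (μ k) ⟨
      - when (¬? (p ∣? k)) (μ k)         ∎
  nonMultiples : sumFrom1 (p * M) (λ k → when (¬? (p ∣? k)) (term k)) ≡ sumFrom1 M g
  nonMultiples = trans (sumFrom1-cong (p * M) coprime-term) (sumFrom1-tail g (m≤n*m M p) beyondM)
    where
    coprime-term : ∀ {k} → 1 ≤ k → k ≤ p * M → when (¬? (p ∣? k)) (term k) ≡ g k
    coprime-term {k} _ _ with p ∣? k | k ∣? p * M | k ∣? M
    ... | yes _  | _        | yes _   = refl
    ... | yes _  | _        | no _    = refl
    ... | no _   | yes _    | yes _   = refl
    ... | no _   | no _     | no _    = refl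
    ... | no p∤k | yes k∣pM | no k∤M  = ⊥-elim (k∤M (coprime-divisor (prime-∤⇒coprime Pp p∤k) k∣pM))
    ... | no _   | no k∤pM  | yes k∣M = ⊥-elim (k∤pM (∣n⇒∣m*n p k∣M))
    beyondM : ∀ {k} → M < k → k ≤ p * M → g k ≡ + 0
    beyondM {k} M<k _ = when-no (k ∣? M) (λ k∣M → <-irrefl refl (≤-trans M<k (∣⇒≤ k∣M))) _

μ-divisorSum≡0 : ∀ N → 2 ≤ N → μ-divisorSum N ≡ + 0
μ-divisorSum≡0 N 2≤N with prime-factor N 2≤N
... | p , Pp , divides M refl =
  subst (λ n → μ-divisorSum n ≡ + 0) (*-comm p M) (μ-divisorSum-prime* M {{M≢0}} Pp)
  where
  M≢0 : NonZero M
  M≢0 = m*n≢0⇒m≢0 M {{>-nonZero (≤-trans (s≤s z≤n) 2≤N)}}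

suc-divMod : ∀ x k .{{_ : NonZero k}} → suc x ≡ x / k * k + suc (x % k)
suc-divMod x k = trans (cong suc (m≡m%n+[m/n]*n x k)) (+-comm (suc (x % k)) (x / k * k))

suc-/ : ∀ x k .{{_ : NonZero k}} → suc x / k ≡ x / k + 𝟙 (k ∣? suc x)
suc-/ x k with k ∣? suc x
... | yes k∣1+x = begin
  suc x / k           ≡⟨ /-congˡ (trans (suc-divMod x k) (cong (_+_ (x / k * k)) 1+r≡k)) ⟩
  (x / k * k + k) / k ≡⟨ /-congˡ (+-comm (x / k * k) k) ⟩
  suc (x / k) * k / k ≡⟨ m*n/n≡m (suc (x / k)) k ⟩
  suc (x / k)         ≡⟨ +-comm 1 (x / k) ⟩
  x / k + 1           ∎
  where
  open ≡-Reasoning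
  1+r≡k : suc (x % k) ≡ k
  1+r≡k = ≤-antisym (m%n<n x k)
    (∣⇒≤ (∣m+n∣m⇒∣n (subst (k ∣_) (suc-divMod x k) k∣1+x) (n∣m*n (x / k))))
... | no k∤1+x = begin
  suc x / k                       ≡⟨ /-congˡ (suc-divMod x k) ⟩
  (x / k * k + suc (x % k)) / k   ≡⟨ +-distrib-/-∣ˡ (suc (x % k)) (n∣m*n (x / k)) ⟩
  x / k * k / k + suc (x % k) / k ≡⟨ cong₂ _+_ (m*n/n≡m (x / k) k) (m<n⇒m/n≡0 1+r<k) ⟩
  x / k + 0                       ∎
  where
  open ≡-Reasoning
  1+r<k : suc (x % k) < k
  1+r<k = ≤∧≢⇒< (m%n<n x k) λ 1+r≡k → k∤1+x (divides (suc (x / k))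
    (trans (suc-divMod x k) (trans (cong (_+_ (x / k * k)) 1+r≡k) (+-comm (x / k * k) k))))

⌊m/jk⌋≡⌊⌊m/j⌋/k⌋ : ∀ m j k → ⌊ m / j * suc k ⌋ ≡ ⌊ ⌊ m / j ⌋ / suc k ⌋
⌊m/jk⌋≡⌊⌊m/j⌋/k⌋ m zero    k = refl
⌊m/jk⌋≡⌊⌊m/j⌋/k⌋ m (suc j) k = sym (m/n/o≡m/[n*o] m (suc j) (suc k))

μ-floorSum : ℕ → ℕ → ℤ
μ-floorSum N x = sumFrom1 N (λ k → + ⌊ x / k ⌋ ℤ.* μ k)

μ-floorSum-zero : ∀ N → μ-floorSum N 0 ≡ + 0
μ-floorSum-zero N = sumFrom1-zero N λ { {suc k} _ _ → ℤ.*-zeroˡ (μ (suc k)) }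

μ-floorSum-suc : ∀ {N x} → suc x ≤ N → μ-floorSum N (suc x) ≡ μ-floorSum N x ℤ.+ μ-divisorSum (suc x)
μ-floorSum-suc {N} {x} 1+x≤N = begin
  μ-floorSum N (suc x)
    ≡⟨ sumFrom1-cong N step ⟩
  sumFrom1 N (λ k → + ⌊ x / k ⌋ ℤ.* μ k ℤ.+ when (k ∣? suc x) (μ k))
    ≡⟨ sumFrom1-+ (λ k → + ⌊ x / k ⌋ ℤ.* μ k) (λ k → when (k ∣? suc x) (μ k)) N ⟩
  μ-floorSum N x ℤ.+ sumFrom1 N (λ k → when (k ∣? suc x) (μ k))
    ≡⟨ cong (ℤ._+_ (μ-floorSum N x)) (sumFrom1-tail _ 1+x≤N nonDivisors) ⟩
  μ-floorSum N x ℤ.+ μ-divisorSum (suc x)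
    ∎
  where
  open ≡-Reasoning
  step : ∀ {k} → 1 ≤ k → k ≤ N → + ⌊ suc x / k ⌋ ℤ.* μ k ≡ + ⌊ x / k ⌋ ℤ.* μ k ℤ.+ when (k ∣? suc x) (μ k)
  step {k@(suc _)} _ _ = begin
    + (suc x / k) ℤ.* μ k
      ≡⟨ cong (λ n → + n ℤ.* μ k) (suc-/ x k) ⟩
    + (x / k + 𝟙 (k ∣? suc x)) ℤ.* μ k
      ≡⟨ cong (ℤ._* μ k) (ℤ.pos-+ (x / k) (𝟙 (k ∣? suc x))) ⟩
    (+ (x / k) ℤ.+ + 𝟙 (k ∣? suc x)) ℤ.* μ k
      ≡⟨ ℤ.*-distribʳ-+ (μ k) (+ (x / k)) (+ 𝟙 (k ∣? suc x)) ⟩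
    + (x / k) ℤ.* μ k ℤ.+ + 𝟙 (k ∣? suc x) ℤ.* μ k
      ≡⟨ cong (ℤ._+_ (+ (x / k) ℤ.* μ k)) (𝟙*≡when (k ∣? suc x) (μ k)) ⟩
    + (x / k) ℤ.* μ k ℤ.+ when (k ∣? suc x) (μ k)
      ∎
  nonDivisors : ∀ {k} → suc x < k → k ≤ N → when (k ∣? suc x) (μ k) ≡ + 0
  nonDivisors x<k _ = when-no (_ ∣? suc x) (λ k∣1+x → <-irrefl refl (≤-trans x<k (∣⇒≤ k∣1+x))) _

μ-floorSum≡1 : ∀ {N x} → 1 ≤ x → x ≤ N → μ-floorSum N x ≡ + 1
μ-floorSum≡1 {N} {1} _ 1≤N =
  trans (μ-floorSum-suc 1≤N) (cong (ℤ._+ μ-divisorSum 1) (μ-floorSum-zero N))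
μ-floorSum≡1 {N} {suc (suc x)} _ 2+x≤N = trans (μ-floorSum-suc 2+x≤N)
  (cong₂ ℤ._+_ (μ-floorSum≡1 (s≤s z≤n) (≤-trans (n≤1+n _) 2+x≤N))
               (μ-divisorSum≡0 (suc (suc x)) (s≤s (s≤s z≤n))))

μ-floorSum-⌊/⌋ : ∀ {m j} → 1 ≤ j → j ≤ m → μ-floorSum m ⌊ m / j ⌋ ≡ + 1
μ-floorSum-⌊/⌋ {m} {suc j} _ j≤m = μ-floorSum≡1 (m≥n⇒m/n>0 j≤m) (m/n≤m m (suc j))

μ-floorSum-⌊/⌋-small : ∀ {m j} → m < j → μ-floorSum m ⌊ m / j ⌋ ≡ + 0
μ-floorSum-⌊/⌋-small {m} {suc j} m<j = trans (cong (μ-floorSum m) (m<n⇒m/n≡0 m<j)) (μ-floorSum-zero m)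

floorDifference-μ-sum : ∀ m j →
  sumFrom1 m (λ k → (+ ⌊ m / j * k ⌋ ℤ.- + (2 * ⌊ m / 2 * j * k ⌋)) ℤ.* μ k)
    ≡ μ-floorSum m ⌊ m / j ⌋ ℤ.+ (- + 2) ℤ.* μ-floorSum m ⌊ m / 2 * j ⌋
floorDifference-μ-sum m j = trans (sumFrom1-cong m term≡) (trans (sumFrom1-+ f (λ k → (- + 2) ℤ.* g k) m)
  (cong (ℤ._+_ (μ-floorSum m ⌊ m / j ⌋)) (sumFrom1-*ˡ (- + 2) g m)))
  where
  f g : ℕ → ℤ
  f k = + ⌊ ⌊ m / j ⌋ / k ⌋ ℤ.* μ k
  g k = + ⌊ ⌊ m / 2 * j ⌋ / k ⌋ ℤ.* μ k
  linear : ∀ a b u → (+ a ℤ.- + (2 * b)) ℤ.* u ≡ + a ℤ.* u ℤ.+ (- + 2) ℤ.* (+ b ℤ.* u)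
  linear a b u rewrite ℤ.pos-* 2 b =
    solve 3 (λ a b u → (a :- con (+ 2) :* b) :* u := a :* u :+ con (- + 2) :* (b :* u)) refl (+ a) (+ b) u
    where open +-*-Solver
  term≡ : ∀ {k} → 1 ≤ k → k ≤ m → (+ ⌊ m / j * k ⌋ ℤ.- + (2 * ⌊ m / 2 * j * k ⌋)) ℤ.* μ k ≡ f k ℤ.+ (- + 2) ℤ.* g k
  term≡ {suc k} _ _ rewrite ⌊m/jk⌋≡⌊⌊m/j⌋/k⌋ m j k | ⌊m/jk⌋≡⌊⌊m/j⌋/k⌋ m (2 * j) k =
    linear ⌊ ⌊ m / j ⌋ / suc k ⌋ ⌊ ⌊ m / 2 * j ⌋ / suc k ⌋ (μ (suc k))

mainTheorem2 : (j m : ℕ) → 1 ≤ j → j ≤ m →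
    (2 * j ≤ m → sumFrom1 m (λ k → (+ ⌊ m / j * k ⌋ ℤ.- + (2 * ⌊ m / 2 * j * k ⌋)) ℤ.* μ k) ≡ - + 1)
    × (m < 2 * j → sumFrom1 m (λ k → (+ ⌊ m / j * k ⌋ ℤ.- + (2 * ⌊ m / 2 * j * k ⌋)) ℤ.* μ k) ≡ + 1)
mainTheorem2 j m 1≤j j≤m =
    (λ 2j≤m → trans (floorDifference-μ-sum m j) (cong₂ (λ a b → a ℤ.+ (- + 2) ℤ.* b)
      (μ-floorSum-⌊/⌋ 1≤j j≤m) (μ-floorSum-⌊/⌋ (≤-trans 1≤j (m≤n*m j 2)) 2j≤m)))
  , (λ m<2j → trans (floorDifference-μ-sum m j) (cong₂ (λ a b → a ℤ.+ (- + 2) ℤ.* b)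
      (μ-floorSum-⌊/⌋ 1≤j j≤m) (μ-floorSum-⌊/⌋-small m<2j)))
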